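{- Let $n,m$ be positive integers and $G$ a connected graph of order $n$. If the twin graph $G^{\ast}$ is almost asymmetric and $n-\max_{v^{\ast}\in V(G^{\ast})}|v^{\ast}|\neq m$, then $D(G)\neq n-m$.
   Context: Two vertices $u\neq v$ of $G$ are twins if $N(v)\setminus\{u\}=N(u)\setminus\{v\}$ (same open or same closed neighbourhood). Let $u\equiv v$ iff $u=v$ or $u,v$ are twins; this is an equivalence relation and $v^{\ast}$ denotes the class of $v$. The twin graph $G^{\ast}$ has vertex set $\{v^{\ast}:v\in V(G)\}$ and $u^{\ast}v^{\ast}$ is an edge iff $uv\in E(G)$. $G^{\ast}$ is called almost asymmetric if for any two distinct vertices $v_i^{\ast},v_j^{\ast}$ of $G^{\ast}$ there is no non-trivial automorphism of $G$ mapping some vertex of $v_i^{\ast}$ to some vertex of $v_j^{\ast}$. $D(G)$ is the distinguishing number (minimum number of colours in a not necessarily proper vertex colouring preserved by no non-trivial automorphism). -}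

module Defs where

open import Data.Nat using (ℕ; zero; suc; _⊔_; _<_)
open import Data.Bool using (Bool; true; false)
open import Data.Bool.Properties using () renaming (_≟_ to _≟ᵇ_)
open import Data.Fin using (Fin)
open import Data.Fin.Properties using (all?) renaming (_≟_ to _≟ᶠ_)
open import Data.Fin.Permutation using (Permutation′; _⟨$⟩ʳ_)
open import Data.Vec using (allFin; count; foldr)
import Data.Vec as V
open import Data.Product using (Σ; ∃; _×_; _,_)
open import Data.Sum using (_⊎_)
open import Relation.Nullary using (¬_; Dec; yes; no)
open import Relation.Nullary.Decidable using (_→-dec_; _⊎-dec_; ¬?)
open import Relation.Binary.PropositionalEquality using (_≡_; _≢_)

record Graph (n : ℕ) : Set where
  field
    adj    : Fin n → Fin n → Bool
    sym    : ∀ u v → adj u v ≡ adj v u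
    irrefl : ∀ v → adj v v ≡ false
open Graph public

module _ {n : ℕ} (G : Graph n) where

  data Reachable : Fin n → Fin n → Set where
    here : ∀ {v} → Reachable v v
    step : ∀ {u w v} → adj G u w ≡ true → Reachable w v → Reachable u v

  Connected : Set
  Connected = ∀ u v → Reachable u v

  -- u ≠ v are twins iff N(v)∖{u} = N(u)∖{v}, i.e. every w ∉ {u,v} is adjacent
  -- to u exactly when it is adjacent to v (u,v are never in their own neighbourhoods).
  Twins : Fin n → Fin n → Set
  Twins u v = u ≢ v × (∀ w → w ≢ u → w ≢ v → adj G u w ≡ adj G v w)

  TwinEquiv : Fin n → Fin n → Set
  TwinEquiv u v = u ≡ v ⊎ Twins u v

  twins? : ∀ u v → Dec (Twins u v)
  twins? u v with u ≟ᶠ v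
  ... | yes p = no λ { (q , _) → q p }
  ... | no q with all? (λ w → ¬? (w ≟ᶠ u) →-dec (¬? (w ≟ᶠ v) →-dec (adj G u w ≟ᵇ adj G v w)))
  ...   | yes h = yes (q , λ w a b → h w a b)
  ...   | no nh = no λ { (_ , h) → nh (λ w a b → h w a b) }

  twinEquiv? : ∀ u v → Dec (TwinEquiv u v)
  twinEquiv? u v = (u ≟ᶠ v) ⊎-dec twins? u v

  classSize : Fin n → ℕ
  classSize v = count (twinEquiv? v) (allFin n)

  maxClassSize : ℕ
  maxClassSize = foldr (λ _ → ℕ) (λ v r → classSize v ⊔ r) 0 (allFin n)

  IsAutomorphism : Permutation′ n → Set
  IsAutomorphism σ = ∀ u v → adj G (σ ⟨$⟩ʳ u) (σ ⟨$⟩ʳ v) ≡ adj G u v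

  NonTrivial : Permutation′ n → Set
  NonTrivial σ = ∃ λ v → σ ⟨$⟩ʳ v ≢ v

  AlmostAsymmetric : Set
  AlmostAsymmetric = ∀ (x y : Fin n) → ¬ TwinEquiv x y →
    ∀ (σ : Permutation′ n) → IsAutomorphism σ → NonTrivial σ → σ ⟨$⟩ʳ x ≢ y

  Distinguishing : (k : ℕ) → (Fin n → Fin k) → Set
  Distinguishing k c = ∀ (σ : Permutation′ n) → IsAutomorphism σ →
    (∀ v → c (σ ⟨$⟩ʳ v) ≡ c v) → ¬ NonTrivial σ

  IsDistinguishingNumber : ℕ → Set
  IsDistinguishingNumber d =
    (Σ (Fin n → Fin d) (Distinguishing d)) ×
    (∀ k → k < d → ¬ Σ (Fin n → Fin k) (Distinguishing k))

-- When G* is almost asymmetric, D(G) is exactly the largest twin-class size M.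
-- Swapping two twins is an automorphism, so a distinguishing colouring is injective
-- on every twin class and D(G) ≥ M.  Conversely, colour each vertex by its rank
-- inside its twin class: this uses M colours, an automorphism preserving it cannot
-- move a vertex to another class (almost asymmetry) nor inside its class (ranks
-- there are distinct), so D(G) ≤ M.  Then D(G) = n − m forces n − M = m, unless
-- n − m truncates to 0, which no colouring of a nonempty graph achieves.
module Submission where

open import Defs hiding (sym)
open import Data.Nat using (ℕ; _≤_; _∸_)
open import Relation.Nullary using (¬_)
open import Relation.Binary.PropositionalEquality using (_≢_)

import Data.Nat as ℕ
open import Data.Nat using (_<_; _⊔_; z≤n; s≤s; _≤?_)
open import Data.Nat.Properties
  using (m≤n⇒m≤1+n; ≤-trans; m≤m⊔n; m≤n⊔m; ⊔-lub; <-irrefl; ≮⇒≥; ≰⇒>; <⇒≤;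
         <⇒≢; ≤-antisym; m≤n⇒m∸n≡0; m∸[m∸n]≡n)
open import Data.Fin using (Fin; zero; suc; toℕ; fromℕ<) renaming (_<_ to _<ᶠ_)
import Data.Fin.Properties as Fin
open import Data.Fin.Permutation using (_⟨$⟩ʳ_; transpose)
open import Data.Vec using (Vec; []; _∷_; lookup; count; allFin; foldr)
open import Data.Vec.Properties using (lookup-allFin)
open import Data.Vec.Membership.Propositional using (_∈_)
open import Data.Vec.Membership.Propositional.Properties using (∈-tabulate⁺)
open import Data.Vec.Relation.Unary.Any using (here; there)
open import Data.Product using (Σ; _×_; _,_; proj₁; proj₂)
open import Data.Sum using (inj₁; inj₂)
open import Function using (id; _∘_; Injective)
open import Level using (0ℓ)
open import Relation.Nullary using (Dec; yes; no; contradiction)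
open import Relation.Nullary.Decidable using (_×-dec_; dec-true; dec-false)
open import Relation.Unary using (Pred; Decidable; _⊆_)
open import Relation.Binary using (tri<; tri≈; tri>)
open import Relation.Binary.PropositionalEquality
  using (_≡_; refl; sym; trans; cong; subst; module ≡-Reasoning)

module _ {A : Set} {P Q : Pred A 0ℓ} (P? : Decidable P) (Q? : Decidable Q) (P⊆Q : P ⊆ Q) where

  count-mono : ∀ {k} (xs : Vec A k) → count P? xs ≤ count Q? xs
  count-mono [] = z≤n
  count-mono (x ∷ xs) with P? x | Q? x
  ... | yes _ | yes _ = s≤s (count-mono xs)
  ... | yes p | no ¬q = contradiction (P⊆Q p) ¬q
  ... | no _  | yes _ = m≤n⇒m≤1+n (count-mono xs)
  ... | no _  | no _  = count-mono xs

  count-mono-< : ∀ {k x} {xs : Vec A k} → x ∈ xs → Q x → ¬ P x → count P? xs < count Q? xs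
  count-mono-< {xs = y ∷ ys} (here refl) q ¬p with P? y | Q? y
  ... | yes p | _     = contradiction p ¬p
  ... | no _  | yes _ = s≤s (count-mono ys)
  ... | no _  | no ¬q = contradiction q ¬q
  count-mono-< {xs = y ∷ ys} (there x∈ys) q ¬p with P? y | Q? y
  ... | yes _ | yes _ = s≤s (count-mono-< x∈ys q ¬p)
  ... | yes p | no ¬q = contradiction (P⊆Q p) ¬q
  ... | no _  | yes _ = m≤n⇒m≤1+n (count-mono-< x∈ys q ¬p)
  ... | no _  | no _  = count-mono-< x∈ys q ¬p

module _ {A : Set} {P : Pred A 0ℓ} (P? : Decidable P) where

  count-positions : ∀ {k} (xs : Vec A k) →
    Σ (Fin (count P? xs) → Fin k) λ e → Injective _≡_ _≡_ e × (∀ i → P (lookup xs (e i)))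
  count-positions [] = (λ ()) , (λ {}) , (λ ())
  count-positions {ℕ.suc k} (x ∷ xs) with P? x | count-positions xs
  ... | no _  | e , e-inj , Pe = suc ∘ e , e-inj ∘ Fin.suc-injective , Pe
  ... | yes p | e , e-inj , Pe = e′ , e′-inj , Pe′
    where
    e′ : Fin (ℕ.suc (count P? xs)) → Fin (ℕ.suc k)
    e′ zero    = zero
    e′ (suc i) = suc (e i)
    e′-inj : Injective _≡_ _≡_ e′
    e′-inj {zero}  {zero}  _  = refl
    e′-inj {suc i} {suc j} eq = cong suc (e-inj (Fin.suc-injective eq))
    Pe′ : ∀ i → P (lookup (x ∷ xs) (e′ i))
    Pe′ zero    = p
    Pe′ (suc i) = Pe i

  count≤-injectiveOn : ∀ {k d} (xs : Vec A k) (f : Fin k → Fin d) →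
    (∀ {i j} → P (lookup xs i) → P (lookup xs j) → f i ≡ f j → i ≡ j) →
    count P? xs ≤ d
  count≤-injectiveOn xs f f-inj with count-positions xs
  ... | e , e-inj , Pe = ≮⇒≥ λ d<count →
    let (i , j , i<j , fi≡fj) = Fin.pigeonhole d<count (f ∘ e)
    in Fin.<-irrefl (e-inj (f-inj (Pe i) (Pe j) fi≡fj)) i<j

module _ {A : Set} (f : A → ℕ) where

  foldr-⊔ : ∀ {k} → Vec A k → ℕ
  foldr-⊔ = foldr (λ _ → ℕ) (λ x r → f x ⊔ r) 0

  foldr-⊔-ub : ∀ {k x} {xs : Vec A k} → x ∈ xs → f x ≤ foldr-⊔ xs
  foldr-⊔-ub (here refl)  = m≤m⊔n _ _
  foldr-⊔-ub (there x∈xs) = ≤-trans (foldr-⊔-ub x∈xs) (m≤n⊔m _ _)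

  foldr-⊔-lub : ∀ {k d} (xs : Vec A k) → (∀ x → f x ≤ d) → foldr-⊔ xs ≤ d
  foldr-⊔-lub []       _   = z≤n
  foldr-⊔-lub (x ∷ xs) f≤d = ⊔-lub (f≤d x) (foldr-⊔-lub xs f≤d)

∈-allFin : ∀ {n} (i : Fin n) → i ∈ allFin n
∈-allFin = ∈-tabulate⁺ id

module _ {n : ℕ} (u v : Fin n) where

  data TransposeCase : Fin n → Set where
    at-u  : transpose u v ⟨$⟩ʳ u ≡ v → TransposeCase u
    at-v  : transpose u v ⟨$⟩ʳ v ≡ u → TransposeCase v
    fixed : ∀ {k} → k ≢ u → k ≢ v → transpose u v ⟨$⟩ʳ k ≡ k → TransposeCase k

  transposeCase : ∀ k → TransposeCase k
  transposeCase k with k Fin.≟ u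
  ... | yes refl = at-u (transpose-at-u k)
    where
    transpose-at-u : ∀ k → transpose k v ⟨$⟩ʳ k ≡ v
    transpose-at-u k rewrite dec-true (k Fin.≟ k) refl = refl
  ... | no k≢u with k Fin.≟ v
  ...   | yes refl = at-v (transpose-at-v k k≢u)
    where
    transpose-at-v : ∀ k → k ≢ u → transpose u k ⟨$⟩ʳ k ≡ u
    transpose-at-v k k≢u rewrite dec-false (k Fin.≟ u) k≢u | dec-true (k Fin.≟ k) refl = refl
  ...   | no k≢v = fixed k≢u k≢v transpose-fixed
    where
    transpose-fixed : transpose u v ⟨$⟩ʳ k ≡ k
    transpose-fixed rewrite dec-false (k Fin.≟ u) k≢u | dec-false (k Fin.≟ v) k≢v = refl

  transpose-matchˡ : transpose u v ⟨$⟩ʳ u ≡ v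
  transpose-matchˡ with transposeCase u
  ... | at-u eq        = eq
  ... | at-v eq        = eq
  ... | fixed u≢u _ _  = contradiction refl u≢u

module _ {n : ℕ} (G : Graph n) where

  twins-sym : ∀ {u v} → Twins G u v → Twins G v u
  twins-sym (u≢v , N≡) = u≢v ∘ sym , λ w w≢v w≢u → sym (N≡ w w≢u w≢v)

  twinEquiv-sym : ∀ {u v} → TwinEquiv G u v → TwinEquiv G v u
  twinEquiv-sym (inj₁ u≡v) = inj₁ (sym u≡v)
  twinEquiv-sym (inj₂ t)   = inj₂ (twins-sym t)

  twins-trans : ∀ {u v w} → Twins G u v → Twins G v w → TwinEquiv G u w
  twins-trans {u} {v} {w} (u≢v , Nuv) (v≢w , Nvw) with u Fin.≟ w
  ... | yes u≡w = inj₁ u≡w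
  ... | no u≢w  = inj₂ (u≢w , N≡)
    where
    open ≡-Reasoning
    N≡ : ∀ x → x ≢ u → x ≢ w → adj G u x ≡ adj G w x
    N≡ x x≢u x≢w with x Fin.≟ v
    ... | no x≢v    = trans (Nuv x x≢u x≢v) (Nvw x x≢v x≢w)
    ... | yes refl  = begin
      adj G u x  ≡⟨ Graph.sym G u x ⟩
      adj G x u  ≡⟨ Nvw u u≢v u≢w ⟩
      adj G w u  ≡⟨ Graph.sym G w u ⟩
      adj G u w  ≡⟨ Nuv w (u≢w ∘ sym) (v≢w ∘ sym) ⟩
      adj G x w  ≡⟨ Graph.sym G x w ⟩
      adj G w x  ∎

  twinEquiv-trans : ∀ {u v w} → TwinEquiv G u v → TwinEquiv G v w → TwinEquiv G u w
  twinEquiv-trans (inj₁ refl) q           = q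
  twinEquiv-trans (inj₂ t)    (inj₁ refl) = inj₂ t
  twinEquiv-trans (inj₂ t)    (inj₂ s)    = twins-trans t s

  transpose-twins-isAutomorphism : ∀ {u v} → Twins G u v → IsAutomorphism G (transpose u v)
  transpose-twins-isAutomorphism {u} {v} (_ , N≡) a b
    with transposeCase u v a | transposeCase u v b
  ... | at-u p | at-u q rewrite p | q = trans (Graph.irrefl G v) (sym (Graph.irrefl G u))
  ... | at-u p | at-v q rewrite p | q = Graph.sym G v u
  ... | at-v p | at-u q rewrite p | q = Graph.sym G u v
  ... | at-v p | at-v q rewrite p | q = trans (Graph.irrefl G u) (sym (Graph.irrefl G v))
  ... | at-u p | fixed b≢u b≢v q rewrite p | q = sym (N≡ b b≢u b≢v)
  ... | at-v p | fixed b≢u b≢v q rewrite p | q = N≡ b b≢u b≢v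
  ... | fixed a≢u a≢v p | at-u q rewrite p | q =
        trans (Graph.sym G a v) (trans (sym (N≡ a a≢u a≢v)) (Graph.sym G u a))
  ... | fixed a≢u a≢v p | at-v q rewrite p | q =
        trans (Graph.sym G a u) (trans (N≡ a a≢u a≢v) (Graph.sym G v a))
  ... | fixed _ _ p | fixed _ _ q rewrite p | q = refl

  distinguishing-separates-twins : ∀ {d} {c : Fin n → Fin d} → Distinguishing G d c →
    ∀ {u v} → Twins G u v → c u ≢ c v
  distinguishing-separates-twins {c = c} dist {u} {v} t@(u≢v , _) cu≡cv =
    dist (transpose u v) (transpose-twins-isAutomorphism t) preserves
      (u , λ σu≡u → u≢v (trans (sym σu≡u) (transpose-matchˡ u v)))
    where
    preserves : ∀ k → c (transpose u v ⟨$⟩ʳ k) ≡ c k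
    preserves k with transposeCase u v k
    ... | at-u p      rewrite p = sym cu≡cv
    ... | at-v p      rewrite p = cu≡cv
    ... | fixed _ _ p rewrite p = refl

  classSize≤colours : ∀ {d} {c : Fin n → Fin d} → Distinguishing G d c → ∀ v → classSize G v ≤ d
  classSize≤colours {c = c} dist v =
    count≤-injectiveOn (twinEquiv? G v) (allFin n) c c-inj
    where
    c-inj : ∀ {i j} → TwinEquiv G v (lookup (allFin n) i) → TwinEquiv G v (lookup (allFin n) j) →
      c i ≡ c j → i ≡ j
    c-inj {i} {j} v~i v~j ci≡cj with i Fin.≟ j
    ... | yes i≡j = i≡j
    ... | no i≢j rewrite lookup-allFin i | lookup-allFin j with twinEquiv-trans (twinEquiv-sym v~i) v~j
    ...   | inj₁ i≡j = contradiction i≡j i≢j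
    ...   | inj₂ t   = contradiction ci≡cj (distinguishing-separates-twins dist t)

  maxClassSize≤colours : ∀ {d} {c : Fin n → Fin d} → Distinguishing G d c → maxClassSize G ≤ d
  maxClassSize≤colours dist = foldr-⊔-lub (classSize G) (allFin n) (classSize≤colours dist)

  precedingTwin? : ∀ v u → Dec (u <ᶠ v × TwinEquiv G v u)
  precedingTwin? v u = (u Fin.<? v) ×-dec twinEquiv? G v u

  rank : Fin n → ℕ
  rank v = count (precedingTwin? v) (allFin n)

  rank<classSize : ∀ v → rank v < classSize G v
  rank<classSize v = count-mono-< (precedingTwin? v) (twinEquiv? G v) proj₂
    (∈-allFin v) (inj₁ refl) (Fin.<-irrefl refl ∘ proj₁)

  rank-mono-< : ∀ {a b} → TwinEquiv G a b → a <ᶠ b → rank a < rank b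
  rank-mono-< {a} {b} a~b a<b = count-mono-< (precedingTwin? a) (precedingTwin? b)
    (λ (x<a , a~x) → Fin.<-trans x<a a<b , twinEquiv-trans (twinEquiv-sym a~b) a~x)
    (∈-allFin a) (a<b , twinEquiv-sym a~b) (Fin.<-irrefl refl ∘ proj₁)

  rank-injectiveOnClasses : ∀ {a b} → TwinEquiv G a b → rank a ≡ rank b → a ≡ b
  rank-injectiveOnClasses {a} {b} a~b ra≡rb with Fin.<-cmp a b
  ... | tri< a<b _ _  = contradiction ra≡rb (<⇒≢ (rank-mono-< a~b a<b))
  ... | tri≈ _ a≡b _  = a≡b
  ... | tri> _ _ b<a  = contradiction (sym ra≡rb) (<⇒≢ (rank-mono-< (twinEquiv-sym a~b) b<a))

  rankColouring : Fin n → Fin (maxClassSize G)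
  rankColouring v =
    fromℕ< (≤-trans (rank<classSize v) (foldr-⊔-ub (classSize G) (∈-allFin v)))

  rankColouring≡⇒rank≡ : ∀ {a b} → rankColouring a ≡ rankColouring b → rank a ≡ rank b
  rankColouring≡⇒rank≡ {a} {b} ca≡cb = begin
    rank a                 ≡⟨ Fin.toℕ-fromℕ< _ ⟨
    toℕ (rankColouring a)  ≡⟨ cong toℕ ca≡cb ⟩
    toℕ (rankColouring b)  ≡⟨ Fin.toℕ-fromℕ< _ ⟩
    rank b                 ∎
    where open ≡-Reasoning

  rankColouring-distinguishing : AlmostAsymmetric G → Distinguishing G (maxClassSize G) rankColouring
  rankColouring-distinguishing almostAsym σ aut preserves (x , σx≢x) with twinEquiv? G x (σ ⟨$⟩ʳ x)
  ... | no ¬x~σx = almostAsym x (σ ⟨$⟩ʳ x) ¬x~σx σ aut (x , σx≢x) refl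
  ... | yes x~σx = σx≢x (sym (rank-injectiveOnClasses x~σx (rankColouring≡⇒rank≡ (sym (preserves x)))))

  distinguishingNumber≡maxClassSize : AlmostAsymmetric G →
    ∀ {d} → IsDistinguishingNumber G d → d ≡ maxClassSize G
  distinguishingNumber≡maxClassSize almostAsym ((_ , dist) , minimal) =
    ≤-antisym
      (≮⇒≥ λ M<d → minimal _ M<d (rankColouring , rankColouring-distinguishing almostAsym))
      (maxClassSize≤colours dist)

mainTheorem9 : (n m : ℕ) → 1 ≤ n → 1 ≤ m → (G : Graph n) → Connected G →
    AlmostAsymmetric G → n ∸ maxClassSize G ≢ m →
    ¬ IsDistinguishingNumber G (n ∸ m)
mainTheorem9 n m 1≤n _ G _ almostAsym n∸M≢m D@((c , _) , _) with m ≤? n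
... | yes m≤n = n∸M≢m (begin
  n ∸ maxClassSize G  ≡⟨ cong (n ∸_) (distinguishingNumber≡maxClassSize G almostAsym D) ⟨
  n ∸ (n ∸ m)         ≡⟨ m∸[m∸n]≡n m≤n ⟩
  m                   ∎)
  where open ≡-Reasoning
... | no m≰n = Fin.¬Fin0 (subst Fin (m≤n⇒m∸n≡0 (<⇒≤ (≰⇒> m≰n))) (c (fromℕ< 1≤n)))
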